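{- Suppose $l,b,s$ are positive integers with $s \geq 2$, and let $G = K_l\vee K_{s,b}$. Let $\{x_1, \ldots, x_{s}\}$ be the partite set of size $s$ of the copy of $K_{s,b}$ used to form $G$. Suppose $L$ is an $(l+s)$-assignment for $G$ such that there exist $i,j \in \{1,\dots,s\}$ with $i \neq j$ and $L(x_i) \cap L(x_j) \neq \emptyset$. Then there is a proper $L$-coloring of $G$.
   Context: All graphs are finite and simple. For graphs $G,H$ on disjoint vertex sets, the join $G \vee H$ is the graph consisting of $G$, $H$, and all edges joining a vertex of $G$ to a vertex of $H$; $K_l$ is the complete graph on $l$ vertices and $K_{s,b}$ the complete bipartite graph with partite sets of sizes $s$ and $b$. A list assignment $L$ for $G$ assigns to each vertex $v$ a set $L(v)$ of colors; it is a $k$-assignment if $|L(v)|=k$ for all $v$. A proper $L$-coloring is a proper coloring $f$ of $G$ with $f(v)\in L(v)$ for every vertex $v$. -}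

module Defs where

open import Data.Nat using (ℕ; _+_)
open import Data.Fin using (Fin)
open import Data.Sum using (_⊎_; inj₁; inj₂)
open import Data.Empty using (⊥)
open import Data.Unit using (⊤)
open import Data.Product using (_×_; ∃)
open import Data.List using (List; length)
open import Data.List.Membership.Propositional using (_∈_)
open import Data.List.Relation.Unary.Unique.Propositional using (Unique)
open import Relation.Nullary using (¬_)
open import Relation.Binary.PropositionalEquality using (_≡_)

-- A graph: vertex type with adjacency relation (the instances below are finite,
-- simple: symmetric, irreflexive).
record Graph : Set₁ where
  field
    V   : Set
    Adj : V → V → Set

open Graph public

K : ℕ → Graph
K l = record { V = Fin l ; Adj = λ u v → ¬ (u ≡ v) }

Kbip : ℕ → ℕ → Graph
Kbip s b = record { V = Fin s ⊎ Fin b ; Adj = adj }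
  where
  adj : Fin s ⊎ Fin b → Fin s ⊎ Fin b → Set
  adj (inj₁ _) (inj₁ _) = ⊥
  adj (inj₁ _) (inj₂ _) = ⊤
  adj (inj₂ _) (inj₁ _) = ⊤
  adj (inj₂ _) (inj₂ _) = ⊥

join : Graph → Graph → Graph
join G H = record { V = V G ⊎ V H ; Adj = adj }
  where
  adj : V G ⊎ V H → V G ⊎ V H → Set
  adj (inj₁ u) (inj₁ v) = Adj G u v
  adj (inj₁ _) (inj₂ _) = ⊤
  adj (inj₂ _) (inj₁ _) = ⊤
  adj (inj₂ u) (inj₂ v) = Adj H u v

-- Colors are natural numbers; a list L(v) is a duplicate-free list of colors.
ListAssignment : Graph → Set
ListAssignment G = V G → List ℕ

IsKAssignment : (G : Graph) → ℕ → ListAssignment G → Set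
IsKAssignment G k L = ∀ v → Unique (L v) × length (L v) ≡ k

IsProperLColoring : (G : Graph) → ListAssignment G → (V G → ℕ) → Set
IsProperLColoring G L f = (∀ v → f v ∈ L v) × (∀ u v → Adj G u v → ¬ (f u ≡ f v))

KlJoinKsb : ℕ → ℕ → ℕ → Graph
KlJoinKsb l s b = join (K l) (Kbip s b)

x : ∀ {l s b} → Fin s → V (KlJoinKsb l s b)
x i = inj₂ (inj₁ i)

{-# OPTIONS --safe #-}
module Submission where

-- Colour x_i and x_j with their common colour c, so that the x's use at most s − 1 colours.
-- Colour K_l greedily with distinct colours avoiding these: the u-th vertex of K_l sees at
-- most (s − 1) + (u − 1) < l + s forbidden colours. Finally every vertex of the b-side sees
-- at most (s − 1) + l < l + s colours, so it too has a free colour in its list.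

open import Defs
open import Level using (Level)
open import Function using (_∘_; Injective)
open import Data.Nat using (ℕ; suc; _+_; _≤_; _<_; _≥_; s≤s)
open import Data.Nat.Properties using (≤-reflexive; ≤-trans; <-≤-trans; ≤-pred; m≤n+m; +-suc; +-monoʳ-≤; +-monoʳ-<; module ≤-Reasoning)
import Data.Nat.Properties as ℕ
open import Data.Fin using (Fin; zero; suc; punchIn; punchOut)
open import Data.Fin.Properties using (punchIn-punchOut)
import Data.Fin.Properties as Fin
open import Data.Product using (∃; _×_; _,_; proj₁; proj₂)
open import Data.Sum using (_⊎_; inj₁; inj₂; [_,_])
open import Data.List using (List; _∷_; length; filter; tabulate; _++_)
open import Data.List.Properties using (filter-notAll; length-++; length-tabulate)
open import Data.List.Relation.Unary.Any using (here; there)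
import Data.List.Relation.Unary.Any as Any
import Data.List.Relation.Unary.All as All
open import Data.List.Relation.Unary.AllPairs using (_∷_)
open import Data.List.Relation.Unary.Unique.Propositional using (Unique)
open import Data.List.Membership.Propositional using (_∈_; _∉_)
open import Data.List.Membership.Propositional.Properties using (∈-filter⁺; ∈-tabulate⁺; ∈-++⁺ˡ; ∈-++⁺ʳ; ∈-length)
import Data.List.Membership.DecPropositional as DecMembership
open import Relation.Nullary using (¬_; Dec; ¬?; yes; no; contradiction; contradiction₂)
open import Relation.Binary.Definitions using (DecidableEquality)
open import Relation.Binary.PropositionalEquality using (_≡_; _≢_; refl; sym; trans; subst; cong; ≢-sym)

private
  variable
    a : Level
    A : Set a
    I : Set
    l s b m N : ℕ

SetsOfSize : ℕ → (I → List A) → Set _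
SetsOfSize N Ls = ∀ k → Unique (Ls k) × length (Ls k) ≡ N

∈∧∉⇒≢ : ∀ {u v : A} {xs} → u ∈ xs → v ∉ xs → u ≢ v
∈∧∉⇒≢ u∈xs v∉xs refl = v∉xs u∈xs

0<length⇒∃∈ : ∀ {xs : List A} → 0 < length xs → ∃ (_∈ xs)
0<length⇒∃∈ {xs = y ∷ _} _ = y , here refl

module _ (_≟_ : DecidableEquality A) where
  open DecMembership _≟_ using (_∈?_)

  ∃-∈-∉ : ∀ {xs F : List A} → Unique xs → length F < length xs → ∃ λ c → c ∈ xs × c ∉ F
  ∃-∈-∉ {y ∷ ys} {F} (y∉ys ∷ !ys) F<y∷ys with y ∈? F
  ... | no y∉F = y , here refl , y∉F
  ... | yes y∈F =
    let c , c∈ys , c∉F-y = ∃-∈-∉ !ys F-y<ys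
    in c , there c∈ys , λ c∈F → c∉F-y (∈-filter⁺ ≢y? c∈F (≢-sym (All.lookup y∉ys c∈ys)))
    where
    ≢y? : ∀ z → Dec (z ≢ y)
    ≢y? z = ¬? (z ≟ y)
    F-y<ys : length (filter ≢y? F) < length ys
    F-y<ys = <-≤-trans (filter-notAll ≢y? F (Any.map (λ y≡z z≢y → z≢y (sym y≡z)) y∈F)) (≤-pred F<y∷ys)

  choice-avoiding : (Ls : I → List A) → SetsOfSize N Ls → ∀ {F} → length F < N →
    ∃ λ (g : I → A) → (∀ k → g k ∈ Ls k) × (∀ k → g k ∉ F)
  choice-avoiding Ls sets {F} F<N = proj₁ ∘ pick , proj₁ ∘ proj₂ ∘ pick , proj₂ ∘ proj₂ ∘ pick
    where
    pick : ∀ k → ∃ λ c → c ∈ Ls k × c ∉ F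
    pick k = ∃-∈-∉ (proj₁ (sets k)) (subst (length F <_) (sym (proj₂ (sets k))) F<N)

  injective-choice-avoiding : (Ls : Fin m → List A) → SetsOfSize N Ls → ∀ {F} → m + length F ≤ N →
    ∃ λ (g : Fin m → A) → (∀ k → g k ∈ Ls k) × (∀ k → g k ∉ F) × Injective _≡_ _≡_ g
  injective-choice-avoiding {m = ℕ.zero} Ls sets _ = (λ ()) , (λ ()) , (λ ()) , λ { {()} }
  injective-choice-avoiding {m = suc m} {N = N} Ls sets {F} room
    with h , h∈Ls , h∉F ← choice-avoiding Ls sets (≤-trans (s≤s (m≤n+m (length F) m)) room)
    with g , g∈Ls , g∉h₀∷F , g-inj ←
           injective-choice-avoiding (Ls ∘ suc) (sets ∘ suc) (subst (_≤ N) (sym (+-suc m (length F))) room)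
    = h₀∷g , h₀∷g∈Ls , h₀∷g∉F , h₀∷g-inj
    where
    h₀∷g : Fin (suc m) → A
    h₀∷g zero = h zero
    h₀∷g (suc k) = g k
    h₀∷g∈Ls : ∀ k → h₀∷g k ∈ Ls k
    h₀∷g∈Ls zero = h∈Ls zero
    h₀∷g∈Ls (suc k) = g∈Ls k
    h₀∷g∉F : ∀ k → h₀∷g k ∉ F
    h₀∷g∉F zero = h∉F zero
    h₀∷g∉F (suc k) = g∉h₀∷F k ∘ there
    h₀∷g-inj : Injective _≡_ _≡_ h₀∷g
    h₀∷g-inj {zero} {zero} _ = refl
    h₀∷g-inj {zero} {suc k} h₀≡gk = contradiction (here (sym h₀≡gk)) (g∉h₀∷F k)
    h₀∷g-inj {suc k} {zero} gk≡h₀ = contradiction (here gk≡h₀) (g∉h₀∷F k)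
    h₀∷g-inj {suc k} {suc k′} gk≡gk′ = cong suc (g-inj gk≡gk′)

choice-with-collision : (Ls : Fin s → List A) → (∀ k → length (Ls k) ≡ N) →
  ∀ {i j c} → c ∈ Ls i → c ∈ Ls j → ∃ λ (g : Fin s → A) → (∀ k → g k ∈ Ls k) × g i ≡ g j
choice-with-collision Ls sizes {i} {j} {c} c∈Lsi c∈Lsj = proj₁ ∘ pick , proj₁ ∘ proj₂ ∘ pick , pick-i≡pick-j
  where
  nonempty : ∀ k → 0 < length (Ls k)
  nonempty k = subst (0 <_) (trans (sizes i) (sym (sizes k))) (∈-length c∈Lsi)
  pick : ∀ k → ∃ λ d → d ∈ Ls k × (k ≡ i ⊎ k ≡ j → d ≡ c)
  pick k with k Fin.≟ i | k Fin.≟ j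
  ... | yes refl | _ = c , c∈Lsi , λ _ → refl
  ... | no _ | yes refl = c , c∈Lsj , λ _ → refl
  ... | no k≢i | no k≢j =
    let d , d∈Lsk = 0<length⇒∃∈ (nonempty k) in d , d∈Lsk , λ k≡i⊎k≡j → contradiction₂ k≡i⊎k≡j k≢i k≢j
  pick-i≡pick-j : proj₁ (pick i) ≡ proj₁ (pick j)
  pick-i≡pick-j = trans (proj₂ (proj₂ (pick i)) (inj₁ refl)) (sym (proj₂ (proj₂ (pick j)) (inj₂ refl)))

collision⇒few-values : (f : Fin s → A) {i j : Fin s} → i ≢ j → f i ≡ f j →
  ∃ λ F → length F < s × (∀ k → f k ∈ F)
collision⇒few-values {s = suc n} f {i} {j} i≢j fi≡fj =
  tabulate (f ∘ punchIn j) , s≤s (≤-reflexive (length-tabulate (f ∘ punchIn j))) , covered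
  where
  covered-off-j : ∀ k → k ≢ j → f k ∈ tabulate (f ∘ punchIn j)
  covered-off-j k k≢j =
    subst (λ k → f k ∈ tabulate (f ∘ punchIn j)) (punchIn-punchOut (≢-sym k≢j)) (∈-tabulate⁺ (punchOut (≢-sym k≢j)))
  covered : ∀ k → f k ∈ tabulate (f ∘ punchIn j)
  covered k with k Fin.≟ j
  ... | yes refl = subst (_∈ tabulate (f ∘ punchIn j)) fi≡fj (covered-off-j i i≢j)
  ... | no k≢j = covered-off-j k k≢j

Proper : (G : Graph) → (V G → A) → Set _
Proper G f = ∀ u v → Adj G u v → f u ≢ f v

K-proper : {f : Fin l → A} → Injective _≡_ _≡_ f → Proper (K l) f
K-proper f-inj _ _ u≢v = u≢v ∘ f-inj

Kbip-proper : (f : Fin s ⊎ Fin b → A) → (∀ k y → f (inj₁ k) ≢ f (inj₂ y)) → Proper (Kbip s b) f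
Kbip-proper f apart (inj₁ k) (inj₂ y) _ = apart k y
Kbip-proper f apart (inj₂ y) (inj₁ k) _ = ≢-sym (apart k y)

join-proper : ∀ {G H} (f : V (join G H) → A) → Proper G (f ∘ inj₁) → Proper H (f ∘ inj₂) →
  (∀ u v → f (inj₁ u) ≢ f (inj₂ v)) → Proper (join G H) f
join-proper f proper-G proper-H apart (inj₁ u) (inj₁ v) = proper-G u v
join-proper f proper-G proper-H apart (inj₁ u) (inj₂ v) _ = apart u v
join-proper f proper-G proper-H apart (inj₂ v) (inj₁ u) _ = ≢-sym (apart u v)
join-proper f proper-G proper-H apart (inj₂ u) (inj₂ v) = proper-H u v

length-tabulate-++-< : (g : Fin l → A) {F : List A} → length F < s → length (tabulate g ++ F) < l + s
length-tabulate-++-< {l = l} g {F} F<s = begin-strict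
  length (tabulate g ++ F)        ≡⟨ length-++ (tabulate g) ⟩
  length (tabulate g) + length F  ≡⟨ cong (_+ length F) (length-tabulate g) ⟩
  l + length F                    <⟨ +-monoʳ-< l F<s ⟩
  _                               ∎
  where open ≤-Reasoning

extend-x-colouring : (L : ListAssignment (KlJoinKsb l s b)) → IsKAssignment (KlJoinKsb l s b) (l + s) L →
  (gx : Fin s → ℕ) → (∀ k → gx k ∈ L (x k)) → (F : List ℕ) → length F < s → (∀ k → gx k ∈ F) →
  ∃ λ f → IsProperLColoring (KlJoinKsb l s b) L f
extend-x-colouring {l} {s} {b} L isAssignment gx gx∈L F F<s gx∈F
  with gK , gK∈L , gK∉F , gK-inj ←
         injective-choice-avoiding ℕ._≟_ (L ∘ inj₁) (isAssignment ∘ inj₁) (+-monoʳ-≤ l (ℕ.<⇒≤ F<s))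
  with gy , gy∈L , gy∉gK++F ←
         choice-avoiding ℕ._≟_ (L ∘ inj₂ ∘ inj₂) (isAssignment ∘ inj₂ ∘ inj₂) (length-tabulate-++-< gK F<s)
  = f , f∈L , join-proper f (K-proper gK-inj) (Kbip-proper (f ∘ inj₂) x-apart-y) K-apart-Kbip
  where
  f : V (KlJoinKsb l s b) → ℕ
  f = [ gK , [ gx , gy ] ]
  f∈L : ∀ v → f v ∈ L v
  f∈L (inj₁ u) = gK∈L u
  f∈L (inj₂ (inj₁ k)) = gx∈L k
  f∈L (inj₂ (inj₂ y)) = gy∈L y
  x-apart-y : ∀ k y → gx k ≢ gy y
  x-apart-y k y = ∈∧∉⇒≢ (∈-++⁺ʳ (tabulate gK) (gx∈F k)) (gy∉gK++F y)
  K-apart-Kbip : ∀ u v → gK u ≢ f (inj₂ v)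
  K-apart-Kbip u (inj₁ k) = ≢-sym (∈∧∉⇒≢ (gx∈F k) (gK∉F u))
  K-apart-Kbip u (inj₂ y) = ∈∧∉⇒≢ (∈-++⁺ˡ (∈-tabulate⁺ u)) (gy∉gK++F y)

lemma18 : (l b s : ℕ) → 1 ≤ l → 1 ≤ b → s ≥ 2 →
    (L : ListAssignment (KlJoinKsb l s b)) →
    IsKAssignment (KlJoinKsb l s b) (l + s) L →
    (∃ λ (i : Fin s) → ∃ λ (j : Fin s) → ¬ (i ≡ j) ×
      (∃ λ (c : ℕ) → c ∈ L (x {l} {s} {b} i) × c ∈ L (x {l} {s} {b} j))) →
    ∃ λ (f : V (KlJoinKsb l s b) → ℕ) → IsProperLColoring (KlJoinKsb l s b) L f
lemma18 l b s _ _ _ L isAssignment (i , j , i≢j , c , c∈Lxi , c∈Lxj)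
  with gx , gx∈L , gxi≡gxj ← choice-with-collision (L ∘ x) (proj₂ ∘ isAssignment ∘ x) c∈Lxi c∈Lxj
  with F , F<s , gx∈F ← collision⇒few-values gx i≢j gxi≡gxj
  = extend-x-colouring L isAssignment gx gx∈L F F<s gx∈F
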